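{- For all $\lambda$-terms: (1) Merge: if $t\Rightarrow_{\neg h}s\to_h u$ then $t\Rightarrow_\beta u$. (2) Indexed split: if $t\Rightarrow_\beta^n s$ then either $t\Rightarrow_{\neg h}s$, or $n>0$ and $t\to_h r\Rightarrow_\beta^{n-1}s$ for some $r$. (3) Split: if $t\Rightarrow_\beta s$ then $t\to_h^* r\Rightarrow_{\neg h}s$ for some $r$. Consequently, $(\Lambda,\{\to_h,\to_{\neg h}\})$ is a macro-step system with respect to $\Rightarrow_\beta$ and $\Rightarrow_{\neg h}$.
   Context: $\Lambda$ is the set of $\lambda$-terms $t::=x\mid\lambda x.t\mid ts$ (up to $\alpha$-equivalence); $t\{x:=s\}$ capture-avoiding substitution; $|t|_x$ the number of free occurrences of $x$ in $t$; $\to_\beta$ the closure of $(\lambda x.t)s\to_\beta t\{x:=s\}$ under abstraction and both sides of application. Head reduction $\to_h$: $(\lambda x.t)s\to_h t\{x:=s\}$; if $t\to_h s$ and $t$ is not an abstraction then $tu\to_h su$; if $t\to_h s$ then $\lambda x.t\to_h\lambda x.s$. $\to_{\neg h}$: if $t\to_\beta t'$ then $(\lambda x.t)s\to_{\neg h}(\lambda x.t')s$ and $st\to_{\neg h}st'$; if $t\to_{\neg h}t'$ then $\lambda x.t\to_{\neg h}\lambda x.t'$ and $ts\to_{\neg h}t's$. Indexed parallel $\beta$, $\Rightarrow_\beta^n$ ($n\in\mathbb N$): $x\Rightarrow_\beta^0x$; if $t\Rightarrow_\beta^n t'$ then $\lambda x.t\Rightarrow_\beta^n\lambda x.t'$;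 if $t\Rightarrow_\beta^nt'$ and $s\Rightarrow_\beta^ms'$ then $ts\Rightarrow_\beta^{n+m}t's'$ and $(\lambda x.t)s\Rightarrow_\beta^{n+|t'|_x\cdot m+1}t'\{x:=s'\}$. Parallel $\beta$: $\Rightarrow_\beta=\bigcup_n\Rightarrow_\beta^n$. Parallel non-head $\Rightarrow_{\neg h}$: $x\Rightarrow_{\neg h}x$; if $t\Rightarrow_\beta t'$ and $s\Rightarrow_\beta s'$ then $(\lambda x.t)s\Rightarrow_{\neg h}(\lambda x.t')s'$; if $t\Rightarrow_{\neg h}t'$ then $\lambda x.t\Rightarrow_{\neg h}\lambda x.t'$; if $t\Rightarrow_{\neg h}t'$ and $s\Rightarrow_\beta s'$ then $ts\Rightarrow_{\neg h}t's'$. A system $(S,\{\to_e,\to_{\neg e}\})$ is a macro-step system w.r.t. relations $\Rightarrow,\Rightarrow_{\neg e}$ if $\to_{\neg e}\subseteq\Rightarrow_{\neg e}\subseteq\to_{\neg e}^*$, if $t\Rightarrow_{\neg e}\cdot\to_e u$ implies $t\Rightarrow u$, and if $t\Rightarrow u$ implies $t\to_e^*\cdot\Rightarrow_{\neg e}u$. -}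

module Defs where

open import Data.Nat using (ℕ; zero; suc; _+_; _*_)
open import Data.Nat using (_≟_)
open import Data.Empty using (⊥)
open import Data.Unit using (⊤)
open import Data.Product using (Σ; ∃; _×_; _,_)
open import Relation.Nullary using (¬_; yes; no)
open import Relation.Binary.Construct.Closure.ReflexiveTransitive using (Star)

-- λ-terms up to α-equivalence, represented with de Bruijn indices.
data Term : Set where
  var : ℕ → Term
  lam : Term → Term
  app : Term → Term → Term

ext : (ℕ → ℕ) → (ℕ → ℕ)
ext ρ zero    = zero
ext ρ (suc n) = suc (ρ n)

rename : (ℕ → ℕ) → Term → Term
rename ρ (var x)   = var (ρ x)
rename ρ (lam t)   = lam (rename (ext ρ) t)
rename ρ (app t s) = app (rename ρ t) (rename ρ s)

exts : (ℕ → Term) → (ℕ → Term)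
exts σ zero    = var zero
exts σ (suc n) = rename suc (σ n)

subst : (ℕ → Term) → Term → Term
subst σ (var x)   = σ x
subst σ (lam t)   = lam (subst (exts σ) t)
subst σ (app t s) = app (subst σ t) (subst σ s)

-- t{0 := s}: substitute s for the bound variable (index 0) of the body t
-- (remaining free indices are decremented).
sub0 : Term → (ℕ → Term)
sub0 s zero    = s
sub0 s (suc n) = var n

_[_] : Term → Term → Term
t [ s ] = subst (sub0 s) t

occ : ℕ → Term → ℕ
occ x (var y) with x ≟ y
... | yes _ = 1
... | no  _ = 0
occ x (lam t)   = occ (suc x) t
occ x (app t s) = occ x t + occ x s

IsLam : Term → Set
IsLam (lam _) = ⊤
IsLam _       = ⊥

infix 4 _→β_ _→h_ _→¬h_ _⇒β[_]_ _⇒β_ _⇒¬h_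

data _→β_ : Term → Term → Set where
  β    : ∀ {t s} → app (lam t) s →β t [ s ]
  ξλ   : ∀ {t t'} → t →β t' → lam t →β lam t'
  ξl   : ∀ {t t' s} → t →β t' → app t s →β app t' s
  ξr   : ∀ {t s s'} → s →β s' → app t s →β app t s'

data _→h_ : Term → Term → Set where
  hβ   : ∀ {t s} → app (lam t) s →h t [ s ]
  happ : ∀ {t s u} → t →h s → ¬ IsLam t → app t u →h app s u
  hlam : ∀ {t s} → t →h s → lam t →h lam s

data _→¬h_ : Term → Term → Set where
  nβbody : ∀ {t t' s} → t →β t' → app (lam t) s →¬h app (lam t') s
  nappr  : ∀ {s t t'} → t →β t' → app s t →¬h app s t'
  nlam   : ∀ {t t'} → t →¬h t' → lam t →¬h lam t'
  nappl  : ∀ {t t' s} → t →¬h t' → app t s →¬h app t' s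

data _⇒β[_]_ : Term → ℕ → Term → Set where
  pvar : ∀ {x} → var x ⇒β[ 0 ] var x
  plam : ∀ {t t' n} → t ⇒β[ n ] t' → lam t ⇒β[ n ] lam t'
  papp : ∀ {t t' s s' n m} → t ⇒β[ n ] t' → s ⇒β[ m ] s' →
         app t s ⇒β[ n + m ] app t' s'
  pβ   : ∀ {t t' s s' n m} → t ⇒β[ n ] t' → s ⇒β[ m ] s' →
         app (lam t) s ⇒β[ n + occ 0 t' * m + 1 ] t' [ s' ]

_⇒β_ : Term → Term → Set
t ⇒β u = ∃ λ n → t ⇒β[ n ] u

data _⇒¬h_ : Term → Term → Set where
  qvar : ∀ {x} → var x ⇒¬h var x
  qβ   : ∀ {t t' s s'} → t ⇒β t' → s ⇒β s' → app (lam t) s ⇒¬h app (lam t') s'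
  qlam : ∀ {t t'} → t ⇒¬h t' → lam t ⇒¬h lam t'
  qapp : ∀ {t t' s s'} → t ⇒¬h t' → s ⇒β s' → app t s ⇒¬h app t' s'

MacroStepSystem : {S : Set} →
  (→e →¬e ⇒ ⇒¬e : S → S → Set) → Set
MacroStepSystem {S} →e →¬e ⇒ ⇒¬e =
  (∀ {t u} → →¬e t u → ⇒¬e t u) ×
  (∀ {t u} → ⇒¬e t u → Star →¬e t u) ×
  (∀ {t s u} → ⇒¬e t s → →e s u → ⇒ t u) ×
  (∀ {t u} → ⇒ t u → Σ S λ r → Star →e t r × ⇒¬e r u)

module Submission where

-- The heart of the matter is the indexed split (2): a parallel step
-- t ⇒β[n] s either contracts no head redex (so it is a parallel non-head
-- step) or it starts with the head contraction t →h r, and what remains,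
-- r ⇒β[n ∸ 1] s, costs exactly one step less.  When the head redex is
-- (λx.u) v ⇒β[n + |u'|·m + 1] u'{x:=v'}, the remainder is u{x:=v} ⇒β u'{x:=v'}
-- and its cost is given by the substitution lemma for indexed parallel
-- reduction.  To state that lemma for arbitrary simultaneous substitutions
-- we weigh a term by a cost per free variable: weight ms t = Σₓ ms x · |t|ₓ.
--
-- The macro-step axioms are then exactly the inclusions, merge and split.

open import Defs
open import Data.Nat using (ℕ; zero; suc; _+_; _*_; _∸_; _<_; _≟_; s≤s; z≤n)
open import Data.Nat.Properties using (+-identityʳ; *-identityʳ; suc-injective; m+n∸n≡m)
open import Data.Nat.Solver using (module +-*-Solver)
open import Data.Product using (Σ; _×_; _,_; proj₂)
open import Data.Sum using (_⊎_; inj₁; inj₂)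
open import Data.Empty using (⊥-elim)
open import Relation.Nullary using (¬_; yes; no)
open import Function using (_∘_)
open import Relation.Binary.PropositionalEquality
  using (_≡_; _≗_; refl; sym; trans; cong; cong₂; module ≡-Reasoning)
open import Relation.Binary.Construct.Closure.ReflexiveTransitive
  using (Star; ε; _◅_; _◅◅_; gmap)
open +-*-Solver using (solve; _:+_; _:*_; _:=_; con)

ext-cong : ∀ {ρ τ} → ρ ≗ τ → ext ρ ≗ ext τ
ext-cong e zero    = refl
ext-cong e (suc n) = cong suc (e n)

rename-cong : ∀ {ρ τ} → ρ ≗ τ → ∀ t → rename ρ t ≡ rename τ t
rename-cong e (var x)   = cong var (e x)
rename-cong e (lam t)   = cong lam (rename-cong (ext-cong e) t)
rename-cong e (app t s) = cong₂ app (rename-cong e t) (rename-cong e s)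

exts-cong : ∀ {σ τ} → σ ≗ τ → exts σ ≗ exts τ
exts-cong e zero    = refl
exts-cong e (suc n) = cong (rename suc) (e n)

subst-cong : ∀ {σ τ} → σ ≗ τ → ∀ t → subst σ t ≡ subst τ t
subst-cong e (var x)   = e x
subst-cong e (lam t)   = cong lam (subst-cong (exts-cong e) t)
subst-cong e (app t s) = cong₂ app (subst-cong e t) (subst-cong e s)

rename-rename : ∀ ρ τ t → rename ρ (rename τ t) ≡ rename (ρ ∘ τ) t
rename-rename ρ τ (var x)   = refl
rename-rename ρ τ (lam t)   =
  cong lam (trans (rename-rename (ext ρ) (ext τ) t)
                  (rename-cong (λ { zero → refl ; (suc n) → refl }) t))
rename-rename ρ τ (app t s) = cong₂ app (rename-rename ρ τ t) (rename-rename ρ τ s)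

rename-subst : ∀ ρ σ t → rename ρ (subst σ t) ≡ subst (rename ρ ∘ σ) t
rename-subst ρ σ (var x)   = refl
rename-subst ρ σ (lam t)   =
  cong lam (trans (rename-subst (ext ρ) (exts σ) t) (subst-cong ext-exts t))
  where
  ext-exts : rename (ext ρ) ∘ exts σ ≗ exts (rename ρ ∘ σ)
  ext-exts zero    = refl
  ext-exts (suc n) = trans (rename-rename (ext ρ) suc (σ n)) (sym (rename-rename suc ρ (σ n)))
rename-subst ρ σ (app t s) = cong₂ app (rename-subst ρ σ t) (rename-subst ρ σ s)

subst-rename : ∀ σ ρ t → subst σ (rename ρ t) ≡ subst (σ ∘ ρ) t
subst-rename σ ρ (var x)   = refl
subst-rename σ ρ (lam t)   =
  cong lam (trans (subst-rename (exts σ) (ext ρ) t)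
                  (subst-cong (λ { zero → refl ; (suc n) → refl }) t))
subst-rename σ ρ (app t s) = cong₂ app (subst-rename σ ρ t) (subst-rename σ ρ s)

subst-subst : ∀ τ σ t → subst τ (subst σ t) ≡ subst (subst τ ∘ σ) t
subst-subst τ σ (var x)   = refl
subst-subst τ σ (lam t)   =
  cong lam (trans (subst-subst (exts τ) (exts σ) t) (subst-cong exts-exts t))
  where
  exts-exts : subst (exts τ) ∘ exts σ ≗ exts (subst τ ∘ σ)
  exts-exts zero    = refl
  exts-exts (suc n) = trans (subst-rename (exts τ) suc (σ n)) (sym (rename-subst suc τ (σ n)))
subst-subst τ σ (app t s) = cong₂ app (subst-subst τ σ t) (subst-subst τ σ s)

subst-var : ∀ t → subst var t ≡ t
subst-var (var x)   = refl
subst-var (lam t)   = cong lam (trans (subst-cong (λ { zero → refl ; (suc n) → refl }) t) (subst-var t))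
subst-var (app t s) = cong₂ app (subst-var t) (subst-var s)

rename-[] : ∀ ρ u v → rename ρ (u [ v ]) ≡ rename (ext ρ) u [ rename ρ v ]
rename-[] ρ u v = trans (rename-subst ρ (sub0 v) u)
  (trans (subst-cong (λ { zero → refl ; (suc n) → refl }) u)
         (sym (subst-rename (sub0 (rename ρ v)) (ext ρ) u)))

subst-[] : ∀ σ u v → subst σ (u [ v ]) ≡ subst (exts σ) u [ subst σ v ]
subst-[] σ u v = trans (subst-subst σ (sub0 v) u)
  (trans (subst-cong sub0-exts u) (sym (subst-subst (sub0 (subst σ v)) (exts σ) u)))
  where
  sub0-exts : subst σ ∘ sub0 v ≗ subst (sub0 (subst σ v)) ∘ exts σ
  sub0-exts zero    = refl
  sub0-exts (suc n) = sym (trans (subst-rename (sub0 (subst σ v)) suc (σ n)) (subst-var (σ n)))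

shift : (ℕ → ℕ) → ℕ → ℕ
shift ms zero    = 0
shift ms (suc y) = ms y

weight : (ℕ → ℕ) → Term → ℕ
weight ms (var x)   = ms x
weight ms (lam t)   = weight (shift ms) t
weight ms (app a b) = weight ms a + weight ms b

shift-cong : ∀ {ms ns} → ms ≗ ns → shift ms ≗ shift ns
shift-cong e zero    = refl
shift-cong e (suc y) = e y

weight-cong : ∀ {ms ns} → ms ≗ ns → ∀ t → weight ms t ≡ weight ns t
weight-cong e (var x)   = e x
weight-cong e (lam t)   = weight-cong (shift-cong e) t
weight-cong e (app a b) = cong₂ _+_ (weight-cong e a) (weight-cong e b)

weight-rename : ∀ ms ρ t → weight ms (rename ρ t) ≡ weight (ms ∘ ρ) t
weight-rename ms ρ (var x)   = refl
weight-rename ms ρ (lam t)   =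
  trans (weight-rename (shift ms) (ext ρ) t) (weight-cong (λ { zero → refl ; (suc n) → refl }) t)
weight-rename ms ρ (app a b) = cong₂ _+_ (weight-rename ms ρ a) (weight-rename ms ρ b)

weight-subst : ∀ ms σ t → weight ms (subst σ t) ≡ weight (weight ms ∘ σ) t
weight-subst ms σ (var x)   = refl
weight-subst ms σ (lam t)   = trans (weight-subst (shift ms) (exts σ) t) (weight-cong shift-exts t)
  where
  shift-exts : weight (shift ms) ∘ exts σ ≗ shift (weight ms ∘ σ)
  shift-exts zero    = refl
  shift-exts (suc n) = weight-rename (shift ms) suc (σ n)
weight-subst ms σ (app a b) = cong₂ _+_ (weight-subst ms σ a) (weight-subst ms σ b)

weight-zero : ∀ t → weight (λ _ → 0) t ≡ 0
weight-zero (var x)   = refl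
weight-zero (lam t)   = trans (weight-cong (λ { zero → refl ; (suc n) → refl }) t) (weight-zero t)
weight-zero (app a b) = cong₂ _+_ (weight-zero a) (weight-zero b)

interchange : ∀ a b c d → (a + b) + (c + d) ≡ (a + c) + (b + d)
interchange = solve 4 (λ a b c d → (a :+ b) :+ (c :+ d) := (a :+ c) :+ (b :+ d)) refl

weight-+ : ∀ ms ns t → weight (λ y → ms y + ns y) t ≡ weight ms t + weight ns t
weight-+ ms ns (var x)   = refl
weight-+ ms ns (lam t)   =
  trans (weight-cong (λ { zero → refl ; (suc n) → refl }) t) (weight-+ (shift ms) (shift ns) t)
weight-+ ms ns (app a b) =
  trans (cong₂ _+_ (weight-+ ms ns a) (weight-+ ms ns b))
        (interchange (weight ms a) (weight ns a) (weight ms b) (weight ns b))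

single : ℕ → ℕ → ℕ → ℕ
single x m y with x ≟ y
... | yes _ = m
... | no  _ = 0

shift-single : ∀ x m → shift (single x m) ≗ single (suc x) m
shift-single x m zero with suc x ≟ zero
... | no _ = refl
shift-single x m (suc y) with x ≟ y | suc x ≟ suc y
... | yes _ | yes _ = refl
... | no  _ | no  _ = refl
... | yes p | no  q = ⊥-elim (q (cong suc p))
... | no  p | yes q = ⊥-elim (p (suc-injective q))

weight-single : ∀ x m t → weight (single x m) t ≡ occ x t * m
weight-single x m (var y) with x ≟ y
... | yes _ = sym (+-identityʳ m)
... | no  _ = refl
weight-single x m (lam t)   =
  trans (weight-cong (shift-single x m) t) (weight-single (suc x) m t)
weight-single x m (app a b) =
  trans (cong₂ _+_ (weight-single x m a) (weight-single x m b))
        (solve 3 (λ a b m → a :* m :+ b :* m := (a :+ b) :* m) refl (occ x a) (occ x b) m)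

occ-weight : ∀ x t → occ x t ≡ weight (single x 1) t
occ-weight x t = sym (trans (weight-single x 1 t) (*-identityʳ (occ x t)))

occ-rename-ext : ∀ ρ u → occ 0 (rename (ext ρ) u) ≡ occ 0 u
occ-rename-ext ρ u = begin
  occ 0 (rename (ext ρ) u)             ≡⟨ occ-weight 0 (rename (ext ρ) u) ⟩
  weight (single 0 1) (rename (ext ρ) u) ≡⟨ weight-rename (single 0 1) (ext ρ) u ⟩
  weight (single 0 1 ∘ ext ρ) u        ≡⟨ weight-cong (λ { zero → refl ; (suc n) → refl }) u ⟩
  weight (single 0 1) u                ≡⟨ sym (occ-weight 0 u) ⟩
  occ 0 u                              ∎
  where open ≡-Reasoning

occ-subst-exts : ∀ σ u → occ 0 (subst (exts σ) u) ≡ occ 0 u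
occ-subst-exts σ u = begin
  occ 0 (subst (exts σ) u)               ≡⟨ occ-weight 0 (subst (exts σ) u) ⟩
  weight (single 0 1) (subst (exts σ) u) ≡⟨ weight-subst (single 0 1) (exts σ) u ⟩
  weight (weight (single 0 1) ∘ exts σ) u ≡⟨ weight-cong only-zero u ⟩
  weight (single 0 1) u                  ≡⟨ sym (occ-weight 0 u) ⟩
  occ 0 u                                ∎
  where
  open ≡-Reasoning
  only-zero : weight (single 0 1) ∘ exts σ ≗ single 0 1
  only-zero zero    = refl
  only-zero (suc n) = trans (weight-rename (single 0 1) suc (σ n)) (weight-zero (σ n))

weight-[] : ∀ ms u v → weight ms (u [ v ]) ≡ weight (shift ms) u + occ 0 u * weight ms v
weight-[] ms u v = begin
  weight ms (u [ v ])                                  ≡⟨ weight-subst ms (sub0 v) u ⟩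
  weight (weight ms ∘ sub0 v) u                        ≡⟨ weight-cong split-costs u ⟩
  weight (λ y → shift ms y + single 0 (weight ms v) y) u
                                     ≡⟨ weight-+ (shift ms) (single 0 (weight ms v)) u ⟩
  weight (shift ms) u + weight (single 0 (weight ms v)) u
                     ≡⟨ cong (weight (shift ms) u +_) (weight-single 0 (weight ms v) u) ⟩
  weight (shift ms) u + occ 0 u * weight ms v          ∎
  where
  open ≡-Reasoning
  split-costs : weight ms ∘ sub0 v ≗ (λ y → shift ms y + single 0 (weight ms v) y)
  split-costs zero    = refl
  split-costs (suc y) = sym (+-identityʳ (ms y))

cast : ∀ {t s s' n m} → t ⇒β[ n ] s → n ≡ m → s ≡ s' → t ⇒β[ m ] s'
cast p refl refl = p

⇒β-refl : ∀ t → t ⇒β[ 0 ] t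
⇒β-refl (var x)   = pvar
⇒β-refl (lam t)   = plam (⇒β-refl t)
⇒β-refl (app t s) = papp (⇒β-refl t) (⇒β-refl s)

rename-⇒β : ∀ ρ {t t' n} → t ⇒β[ n ] t' → rename ρ t ⇒β[ n ] rename ρ t'
rename-⇒β ρ pvar       = pvar
rename-⇒β ρ (plam p)   = plam (rename-⇒β (ext ρ) p)
rename-⇒β ρ (papp p q) = papp (rename-⇒β ρ p) (rename-⇒β ρ q)
rename-⇒β ρ (pβ {t' = u'} {s' = v'} {n = n} {m = m} p q) =
  cast (pβ (rename-⇒β (ext ρ) p) (rename-⇒β ρ q))
       (cong (λ k → n + k * m + 1) (occ-rename-ext ρ u')) (sym (rename-[] ρ u' v'))

_⇒β[_]ˢ_ : (ℕ → Term) → (ℕ → ℕ) → (ℕ → Term) → Set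
σ ⇒β[ ms ]ˢ σ' = ∀ y → σ y ⇒β[ ms y ] σ' y

exts-⇒β : ∀ {σ σ' ms} → σ ⇒β[ ms ]ˢ σ' → exts σ ⇒β[ shift ms ]ˢ exts σ'
exts-⇒β ps zero    = pvar
exts-⇒β ps (suc y) = rename-⇒β suc (ps y)

subst-⇒β : ∀ {σ σ' ms t t' n} → t ⇒β[ n ] t' → σ ⇒β[ ms ]ˢ σ' →
  subst σ t ⇒β[ n + weight ms t' ] subst σ' t'
subst-⇒β pvar       ps = ps _
subst-⇒β (plam p)   ps = plam (subst-⇒β p (exts-⇒β ps))
subst-⇒β {ms = ms} (papp {t' = a} {s' = b} {n = n} {m = m} p q) ps =
  cast (papp (subst-⇒β p ps) (subst-⇒β q ps)) (sym (interchange n m (weight ms a) (weight ms b))) refl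
subst-⇒β {σ' = σ'} {ms} (pβ {t' = u'} {s' = v'} {n = n} {m = m} p q) ps =
  cast (pβ (subst-⇒β p (exts-⇒β ps)) (subst-⇒β q ps)) cost (sym (subst-[] σ' u' v'))
  where
  open ≡-Reasoning
  A = weight (shift ms) u'
  B = weight ms v'
  o = occ 0 u'
  cost : n + A + occ 0 (subst (exts σ') u') * (m + B) + 1 ≡ n + o * m + 1 + weight ms (u' [ v' ])
  cost = begin
    n + A + occ 0 (subst (exts σ') u') * (m + B) + 1
      ≡⟨ cong (λ k → n + A + k * (m + B) + 1) (occ-subst-exts σ' u') ⟩
    n + A + o * (m + B) + 1
      ≡⟨ solve 5 (λ n A o m B → n :+ A :+ o :* (m :+ B) :+ con 1
                               := n :+ o :* m :+ con 1 :+ (A :+ o :* B)) refl n A o m B ⟩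
    n + o * m + 1 + (A + o * B)
      ≡⟨ cong (n + o * m + 1 +_) (sym (weight-[] ms u' v')) ⟩
    n + o * m + 1 + weight ms (u' [ v' ]) ∎

[]-⇒β : ∀ {u u' v v' n m} → u ⇒β[ n ] u' → v ⇒β[ m ] v' →
  u [ v ] ⇒β[ n + occ 0 u' * m ] u' [ v' ]
[]-⇒β {u' = u'} {n = n} {m = m} p q =
  cast (subst-⇒β p sub0-⇒β) (cong (n +_) (weight-single 0 m u')) refl
  where
  sub0-⇒β : sub0 _ ⇒β[ single 0 m ]ˢ sub0 _
  sub0-⇒β zero    = q
  sub0-⇒β (suc y) = pvar

→β⊆⇒β : ∀ {t s} → t →β s → t ⇒β s
→β⊆⇒β (β {t} {s})   = _ , pβ (⇒β-refl t) (⇒β-refl s)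
→β⊆⇒β (ξλ b)        = _ , plam (proj₂ (→β⊆⇒β b))
→β⊆⇒β (ξl {s = s} b) = _ , papp (proj₂ (→β⊆⇒β b)) (⇒β-refl s)
→β⊆⇒β (ξr {t = t} b) = _ , papp (⇒β-refl t) (proj₂ (→β⊆⇒β b))

⇒β⊆→β* : ∀ {t s n} → t ⇒β[ n ] s → Star _→β_ t s
⇒β⊆→β* pvar       = ε
⇒β⊆→β* (plam p)   = gmap lam ξλ (⇒β⊆→β* p)
⇒β⊆→β* (papp p q) = gmap (λ a → app a _) ξl (⇒β⊆→β* p) ◅◅ gmap (app _) ξr (⇒β⊆→β* q)
⇒β⊆→β* (pβ p q)   =
  gmap (λ a → app (lam a) _) (ξl ∘ ξλ) (⇒β⊆→β* p) ◅◅ gmap (app _) ξr (⇒β⊆→β* q) ◅◅ β ◅ ε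

⇒¬h⊆⇒β : ∀ {t s} → t ⇒¬h s → t ⇒β s
⇒¬h⊆⇒β qvar                   = _ , pvar
⇒¬h⊆⇒β (qβ (_ , p) (_ , q))   = _ , papp (plam p) q
⇒¬h⊆⇒β (qlam p)               = _ , plam (proj₂ (⇒¬h⊆⇒β p))
⇒¬h⊆⇒β (qapp p (_ , q))       = _ , papp (proj₂ (⇒¬h⊆⇒β p)) q

⇒¬h-refl : ∀ t → t ⇒¬h t
⇒¬h-refl (var x)   = qvar
⇒¬h-refl (lam t)   = qlam (⇒¬h-refl t)
⇒¬h-refl (app t s) = qapp (⇒¬h-refl t) (_ , ⇒β-refl s)

→¬h⊆⇒¬h : ∀ {t s} → t →¬h s → t ⇒¬h s
→¬h⊆⇒¬h (nβbody {s = s} b) = qβ (→β⊆⇒β b) (_ , ⇒β-refl s)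
→¬h⊆⇒¬h (nappr {s = s} b)  = qapp (⇒¬h-refl s) (→β⊆⇒β b)
→¬h⊆⇒¬h (nlam b)           = qlam (→¬h⊆⇒¬h b)
→¬h⊆⇒¬h (nappl {s = s} b)  = qapp (→¬h⊆⇒¬h b) (_ , ⇒β-refl s)

⇒¬h⊆→¬h* : ∀ {t s} → t ⇒¬h s → Star _→¬h_ t s
⇒¬h⊆→¬h* qvar                 = ε
⇒¬h⊆→¬h* (qβ (_ , p) (_ , q)) =
  gmap (λ a → app (lam a) _) nβbody (⇒β⊆→β* p) ◅◅ gmap (app _) nappr (⇒β⊆→β* q)
⇒¬h⊆→¬h* (qlam p)             = gmap lam nlam (⇒¬h⊆→¬h* p)
⇒¬h⊆→¬h* (qapp p (_ , q))     =
  gmap (λ a → app a _) nappl (⇒¬h⊆→¬h* p) ◅◅ gmap (app _) nappr (⇒β⊆→β* q)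

-- (1) A parallel non-head step followed by a head step is one parallel step:
-- the head redex was already present and is contracted together with it.
merge : ∀ {t s u : Term} → t ⇒¬h s → s →h u → t ⇒β u
merge qvar ()
merge (qβ (_ , p) (_ , q)) hβ          = _ , pβ p q
merge (qβ _ _) (happ _ not-lam)       = ⊥-elim (not-lam _)
merge (qlam p) (hlam h)               = _ , plam (proj₂ (merge p h))
merge (qapp (qlam p) (_ , q)) hβ      = _ , pβ (proj₂ (⇒¬h⊆⇒β p)) q
merge (qapp p (_ , q)) (happ h _)     = _ , papp (proj₂ (merge p h)) q

HeadFirst : Term → ℕ → Term → Set
HeadFirst t n s = 0 < n × Σ Term (λ r → t →h r × r ⇒β[ n ∸ 1 ] s)

HeadFirst-app : ∀ {t t' s s' n m} → ¬ IsLam t →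
  HeadFirst t n t' → s ⇒β[ m ] s' → HeadFirst (app t s) (n + m) (app t' s')
HeadFirst-app not-lam (s≤s z≤n , _ , h , p') q = s≤s z≤n , _ , happ h not-lam , papp p' q

0<k+1 : ∀ k → 0 < k + 1
0<k+1 zero    = s≤s z≤n
0<k+1 (suc k) = s≤s z≤n

indexed-split : ∀ {t s : Term} {n : ℕ} → t ⇒β[ n ] s → t ⇒¬h s ⊎ HeadFirst t n s
indexed-split pvar = inj₁ qvar
indexed-split (plam p) with indexed-split p
... | inj₁ a                 = inj₁ (qlam a)
... | inj₂ (pos , r , h , p') = inj₂ (pos , lam r , hlam h , plam p')
indexed-split (papp pvar q)     = inj₁ (qapp qvar (_ , q))
indexed-split (papp (plam p) q) = inj₁ (qβ (_ , p) (_ , q))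
indexed-split (papp {t = app _ _} p q) with indexed-split p
... | inj₁ a    = inj₁ (qapp a (_ , q))
... | inj₂ head = inj₂ (HeadFirst-app (λ ()) head q)
indexed-split (pβ {t' = u'} {n = n} {m = m} p q) =
  inj₂ (0<k+1 k , _ , hβ , cast ([]-⇒β p q) (sym (m+n∸n≡m k 1)) refl)
  where k = n + occ 0 u' * m

-- (3) Iterating (2) along the index, which drops at each head step.
split-indexed : ∀ n {t s : Term} → t ⇒β[ n ] s → Σ Term (λ r → Star _→h_ t r × r ⇒¬h s)
split-indexed n p with indexed-split p
split-indexed n       p | inj₁ a = _ , ε , a
split-indexed zero    p | inj₂ (() , _)
split-indexed (suc k) p | inj₂ (_ , _ , h , p') with split-indexed k p'
... | r , hs , a = r , h ◅ hs , a

split : ∀ {t s : Term} → t ⇒β s → Σ Term (λ r → Star _→h_ t r × r ⇒¬h s)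
split (n , p) = split-indexed n p

proposition2 : (∀ {t s u : Term} → t ⇒¬h s → s →h u → t ⇒β u) ×
    (∀ {t s : Term} {n : ℕ} → t ⇒β[ n ] s →
    t ⇒¬h s ⊎ (0 < n × Σ Term (λ r → t →h r × r ⇒β[ n ∸ 1 ] s))) ×
    (∀ {t s : Term} → t ⇒β s → Σ Term (λ r → Star _→h_ t r × r ⇒¬h s)) ×
    MacroStepSystem _→h_ _→¬h_ _⇒β_ _⇒¬h_
proposition2 =
  merge , indexed-split , split ,
  (→¬h⊆⇒¬h , ⇒¬h⊆→¬h* , merge , split)
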